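{- For an integer $k\ge 2$, let $(G,\sigma)$ be the vertex-colored digraph with vertex set $L=\{x_1,z_1,x_2,z_2,\dots,x_{2k},z_{2k}\}$, with $2k$ pairwise distinct colors $c_1,\dots,c_{2k}$ such that $\sigma(x_i)=\sigma(z_i)=c_i$ for $1\le i\le 2k$, and with arc set $E=\bigcup_{i=1}^{2k}\{x_ix_{[i+k]},\ x_iz_{[i+k]},\ z_ix_{[i+1]}\}$, where indices $[n]$ are taken modulo $2k$ (with representatives in $\{1,\dots,2k\}$). Then $(G,\sigma)$ is a qBMG that is not binary-explainable. Moreover, every induced subgraph of $(G,\sigma)$ with at most $|L|-2$ vertices is a binary-explainable qBMG.
   Context: All rooted trees are phylogenetic; $v\preceq_T u$ means $u$ is on the path from root $\rho_T$ to $v$; $\mathrm{lca}_T$ is the least common ancestor. In leaf-colored $(T,\sigma)$, $y$ is a best match of $x$ if $\sigma(x)\ne\sigma(y)$ and $\mathrm{lca}_T(x,y)\preceq_T\mathrm{lca}_T(x,y')$ for all leaves $y'$ with $\sigma(y')=\sigma(y)$. A truncation map $u\colon L(T)\times S\to V(T)$ (with $\sigma(L(T))\subseteq S$) sends $(x,s)$ to a vertex on the path from $\rho_T$ to $x$, with $u(x,\sigma(x))=x$; $y$ is a quasi-best match of $x$ if it is a best match and $\mathrm{lca}_T(x,y)\preceq_T u(x,\sigma(y))$; $(T,\sigma,u)$ explains the vertex-colored digraph on $L(T)$ with arcs $xy$ for quasi-best matches $y$ of $x$; such digraphs are qBMGs. A qBMG is binary-explainable if it is explained by some $(T,\sigma,u)$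 with $T$ binary (every inner vertex has exactly two children). Induced subgraphs carry the restricted coloring. -}

module Defs where

open import Data.Nat using (ℕ; zero; suc; _≤_; _+_; _*_; _%_; _≡ᵇ_)
open import Data.Nat.DivMod using (m%n<n)
open import Data.Fin using (Fin; toℕ; fromℕ<)
open import Data.Bool using (Bool; true; false; if_then_else_)
open import Data.List using (List; []; _∷_; _++_; length; cartesianProduct; allFin)
open import Data.List.Relation.Unary.All using (All)
open import Data.List.Relation.Binary.Permutation.Propositional using (_↭_)
open import Data.Product using (Σ; _×_; ∃; ∃-syntax; _,_)
open import Data.Empty using (⊥)
open import Relation.Nullary using (¬_)
open import Relation.Binary.PropositionalEquality using (_≡_)
open import Function.Bundles using (_⇔_)

-- Rooted trees with leaves labelled by elements of V.
-- A vertex of a tree is identified with its address: the list of child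
-- indices on the path from the root (the root is []).

data Tree (V : Set) : Set where
  leaf : V → Tree V
  node : List (Tree V) → Tree V

Addr : Set
Addr = List ℕ

module _ {V : Set} where

  mutual
    leaves : Tree V → List V
    leaves (leaf x)  = x ∷ []
    leaves (node ts) = leavesL ts

    leavesL : List (Tree V) → List V
    leavesL []       = []
    leavesL (t ∷ ts) = leaves t ++ leavesL ts

  data Phylo : Tree V → Set where
    leafP : ∀ {x} → Phylo (leaf x)
    nodeP : ∀ {ts} → 2 ≤ length ts → All Phylo ts → Phylo (node ts)

  data Binary : Tree V → Set where
    leafB : ∀ {x} → Binary (leaf x)
    nodeB : ∀ {l r} → Binary l → Binary r → Binary (node (l ∷ r ∷ []))

  data LeafAt : Tree V → Addr → V → Set where
    here  : ∀ {x} → LeafAt (leaf x) [] x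
    there0 : ∀ {t ts a x} → LeafAt t a x → LeafAt (node (t ∷ ts)) (0 ∷ a) x
    thereS : ∀ {t ts i a x} → LeafAt (node ts) (i ∷ a) x →
             LeafAt (node (t ∷ ts)) (suc i ∷ a) x

-- v ⪯ u  (u lies on the path from the root to v): u is a prefix of v
_⪯_ : Addr → Addr → Set
v ⪯ u = ∃[ s ] (u ++ s ≡ v)

lca : Addr → Addr → Addr
lca [] _ = []
lca (_ ∷ _) [] = []
lca (a ∷ as) (b ∷ bs) = if a ≡ᵇ b then a ∷ lca as bs else []

module _ {V C : Set} (σ : V → C) where

  BestMatch : Tree V → V → Addr → V → Addr → Set
  BestMatch T x ax y ay =
    ¬ (σ x ≡ σ y) ×
    (∀ y' ay' → LeafAt T ay' y' → σ y' ≡ σ y → lca ax ay ⪯ lca ax ay')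

  -- truncation maps u : L(T) × S → V(T), with S = C (the whole colour type)
  Truncation : Tree V → (V → C → Addr) → Set
  Truncation T u = ∀ x ax → LeafAt T ax x →
    (∀ s → ax ⪯ u x s) × (u x (σ x) ≡ ax)

  QuasiBestMatch : Tree V → (V → C → Addr) → V → Addr → V → Addr → Set
  QuasiBestMatch T u x ax y ay =
    BestMatch T x ax y ay × (lca ax ay ⪯ u x (σ y))

  Explains : Tree V → (V → C → Addr) → (E : V → V → Set) → List V → Set
  Explains T u E W =
    (leaves T ↭ W) ×
    (∀ x ax y ay → LeafAt T ax x → LeafAt T ay y →
       E x y ⇔ QuasiBestMatch T u x ax y ay)

  IsQBMG : (V → V → Set) → List V → Set
  IsQBMG E W = ∃[ T ] ∃[ u ] (Phylo T × Truncation T u × Explains T u E W)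

  BinaryExplainable : (V → V → Set) → List V → Set
  BinaryExplainable E W =
    ∃[ T ] ∃[ u ] (Phylo T × Binary T × Truncation T u × Explains T u E W)

-- The graph of the lemma.  Index i : Fin (2k) stands for x_{i+1}, z_{i+1};
-- (i , false) = x_{i+1}, (i , true) = z_{i+1}; colour of (i , _) is i.

addMod : ∀ {n} → Fin n → ℕ → Fin n
addMod {suc n} i a = fromℕ< (m%n<n (toℕ i + a) (suc n))

Vtx : ℕ → Set
Vtx k = Fin (2 * k) × Bool

col : ∀ {k} → Vtx k → Fin (2 * k)
col (i , _) = i

data Arc (k : ℕ) : Vtx k → Vtx k → Set where
  xx : ∀ i → Arc k (i , false) (addMod i k , false)
  xz : ∀ i → Arc k (i , false) (addMod i k , true)
  zx : ∀ i → Arc k (i , true)  (addMod i 1 , false)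

allVtx : (k : ℕ) → List (Vtx k)
allVtx k = cartesianProduct (allFin (2 * k)) (true ∷ false ∷ [])

-- Write x_j, z_j for (j , false), (j , true), with indices from 0 taken mod 2k. A tree explains the
-- graph induced on its leaves, with the truncation that is the root exactly for the colour of a
-- vertex's out-neighbours, as soon as z_j and x_{j+1} are closer to each other than to z_{j+1} and
-- x_{j+k}, z_{j+k} are equally close to x_j; the star of the cherries z_j x_{j+1} does this for the
-- whole graph. Conversely, in a binary tree these requirements put z_j, x_{j+1} and x_{j+k}, z_{j+k}
-- below the same child of the root, and going around the cycle of the indices puts every leaf below
-- one child. Deleting x_m or z_m breaks the cycle: x_m beside the caterpillars z_{m+k-1} … z_m over
-- x_{m+k} … x_{m+1} and z_{m+2k-1} … z_{m+k} over x_{m+2k-1} … x_{m+k+1}, restricted to the remaining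
-- vertices, displays all the required triples.

module Submission where

open import Defs
open import Data.Nat using (ℕ; zero; suc; pred; _+_; _*_; _∸_; _%_; _≤_; _<_; z≤n; s≤s; _≡ᵇ_; _<?_)
open import Data.Nat.Properties
open import Data.Nat.DivMod using (%-distribˡ-+; m%n%n≡m%n; [m+n]%n≡m%n; m<n⇒m%n≡m)
open import Data.Fin using (Fin; toℕ) renaming (zero to fzero; suc to fsuc; _≟_ to _≟ᶠ_)
open import Data.Fin.Properties using (toℕ-fromℕ<; toℕ-injective; toℕ<n)
open import Data.Bool using (Bool; true; false) renaming (_≟_ to _≟ᵇ_)
open import Data.Bool.Properties using (¬-not)
open import Data.Maybe using (Maybe; just; nothing)
open import Data.List using (List; []; _∷_; _++_; length; map; tabulate; allFin; cartesianProduct)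
open import Data.List.Properties
  using (++-identityʳ; ++-assoc; ++-conicalˡ; length-++; length-map; length-tabulate; map-tabulate)
open import Data.List.Membership.Propositional using (_∈_; _∉_)
open import Data.List.Membership.Propositional.Properties
  using (∈-++⁺ˡ; ∈-++⁺ʳ; ∈-++⁻; ∈-allFin; ∈-cartesianProduct⁺)
open import Data.List.Membership.Propositional.Properties.WithK using (unique∧set⇒bag)
open import Data.List.Relation.Unary.Any using (here; there; satisfied)
open import Data.List.Relation.Unary.All as All using ([]; _∷_; all?)
open import Data.List.Relation.Unary.All.Properties using (¬All⇒Any¬; ++⁻ˡ; ++⁻ʳ; tabulate⁺)
open import Data.List.Relation.Unary.AllPairs using ([]; _∷_)
open import Data.List.Relation.Unary.Unique.Propositional using (Unique)
open import Data.List.Relation.Unary.Unique.Propositional.Properties using (++⁺; map⁻; cartesianProduct⁺; allFin⁺)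
open import Data.List.Relation.Binary.Disjoint.Propositional using (Disjoint)
open import Data.List.Relation.Binary.Permutation.Propositional using (_↭_; ↭-sym; ↭⇒↭ₛ)
open import Data.List.Relation.Binary.Permutation.Propositional.Properties using (∈-resp-↭; ↭-length)
import Data.List.Relation.Binary.Permutation.Setoid.Properties as Permutationₛ
open import Data.List.Relation.Binary.BagAndSetEquality using (∼bag⇒↭)
open import Data.Product using (_×_; ∃-syntax; _,_; proj₁; proj₂)
open import Data.Product.Properties using (≡-dec)
open import Data.Sum using (_⊎_; inj₁; inj₂)
open import Data.Empty using (⊥; ⊥-elim)
open import Data.Unit using (⊤; tt)
open import Function using (id; _∘_; _$_)
open import Function.Bundles using (_⇔_; mk⇔; Equivalence)
open import Relation.Nullary using (¬_; Dec; yes; no)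
open import Relation.Unary using (Decidable)
open import Relation.Binary.Definitions using (DecidableEquality)
open import Relation.Binary.PropositionalEquality

module _ {A : Set} where

  Unique-++⁻ : ∀ (xs : List A) {ys} → Unique (xs ++ ys) → Unique xs × Unique ys × Disjoint xs ys
  Unique-++⁻ []       u          = [] , u , λ ()
  Unique-++⁻ (x ∷ xs) (x∉ ∷ u) with Unique-++⁻ xs u
  ... | uxs , uys , disj = ++⁻ˡ xs x∉ ∷ uxs , uys , λ where
    (here refl , v∈ys) → All.lookup (++⁻ʳ xs x∉) v∈ys refl
    (there v∈xs , v∈ys) → disj (v∈xs , v∈ys)

  Unique-resp-↭ : ∀ {xs ys : List A} → xs ↭ ys → Unique xs → Unique ys
  Unique-resp-↭ p = Permutationₛ.Unique-resp-↭ (setoid A) (↭⇒↭ₛ p)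

  unique-same-elements⇒↭ : ∀ {xs ys : List A} → Unique xs → Unique ys →
    (∀ {v} → v ∈ xs → v ∈ ys) → (∀ {v} → v ∈ ys → v ∈ xs) → xs ↭ ys
  unique-same-elements⇒↭ uxs uys ⊆ ⊇ = ∼bag⇒↭ (unique∧set⇒bag uxs uys (mk⇔ ⊆ ⊇))

module _ {A : Set} (_≟_ : DecidableEquality A) where
  open import Data.List.Membership.DecPropositional _≟_ using (_∈?_)

  ∃∉-shorter : ∀ {xs ys : List A} → Unique xs → Unique ys → (∀ {v} → v ∈ ys → v ∈ xs) →
    length ys < length xs → ∃[ v ] v ∉ ys
  ∃∉-shorter {xs} {ys} uxs uys ys⊆xs shorter with all? (_∈? ys) xs
  ... | yes xs⊆ys =
    ⊥-elim (<-irrefl (sym (↭-length (unique-same-elements⇒↭ uxs uys (All.lookup xs⊆ys) ys⊆xs))) shorter)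
  ... | no xs⊈ys  = satisfied (¬All⇒Any¬ (_∈? ys) xs xs⊈ys)

length-cartesianProduct : ∀ {A B : Set} (xs : List A) (ys : List B) →
  length (cartesianProduct xs ys) ≡ length xs * length ys
length-cartesianProduct []       ys = refl
length-cartesianProduct (x ∷ xs) ys =
  trans (length-++ (map (x ,_) ys)) (cong₂ _+_ (length-map (x ,_) ys) (length-cartesianProduct xs ys))

_≺_ : Addr → Addr → Set
v ≺ u = v ⪯ u × ¬ (u ⪯ v)

⪯-refl : ∀ a → a ⪯ a
⪯-refl a = [] , ++-identityʳ a

⪯-reflexive : ∀ {a b} → a ≡ b → a ⪯ b
⪯-reflexive {a} refl = ⪯-refl a

⪯-root : ∀ a → a ⪯ []
⪯-root a = a , refl

root⋠∷ : ∀ {i a} → ¬ ([] ⪯ (i ∷ a))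
root⋠∷ (_ , ())

[]⪯⇒≡[] : ∀ {a} → [] ⪯ a → a ≡ []
[]⪯⇒≡[] {a} (s , a++s≡[]) = ++-conicalˡ a s a++s≡[]

⪯-trans : ∀ {a b c} → a ⪯ b → b ⪯ c → a ⪯ c
⪯-trans {c = c} (s , b++s≡a) (s′ , c++s′≡b) =
  s′ ++ s , trans (sym (++-assoc c s′ s)) (trans (cong (_++ s) c++s′≡b) b++s≡a)

⪯-∷ : ∀ {i a b} → a ⪯ b → (i ∷ a) ⪯ (i ∷ b)
⪯-∷ (s , e) = s , cong (_ ∷_) e

⪯-∷⁻ : ∀ {i a b} → (i ∷ a) ⪯ (i ∷ b) → a ⪯ b
⪯-∷⁻ (s , refl) = s , refl

≺-∷ : ∀ {i a b} → a ≺ b → (i ∷ a) ≺ (i ∷ b)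
≺-∷ (a⪯b , b⋠a) = ⪯-∷ a⪯b , b⋠a ∘ ⪯-∷⁻

lca-∷-≡ : ∀ i a b → lca (i ∷ a) (i ∷ b) ≡ i ∷ lca a b
lca-∷-≡ i a b with i ≡ᵇ i | ≡⇒≡ᵇ i i refl
... | true | _ = refl

lca-∷-≢ : ∀ {i j} a b → i ≢ j → lca (i ∷ a) (j ∷ b) ≡ []
lca-∷-≢ {i} {j} a b i≢j with i ≡ᵇ j | ≡ᵇ⇒≡ i j
... | true  | i≡j = ⊥-elim (i≢j (i≡j tt))
... | false | _   = refl

lca-comm : ∀ a b → lca a b ≡ lca b a
lca-comm []      []      = refl
lca-comm []      (_ ∷ _) = refl
lca-comm (_ ∷ _) []      = refl
lca-comm (i ∷ a) (j ∷ b) with i ≟ j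
... | yes refl = trans (lca-∷-≡ i a b) (trans (cong (i ∷_) (lca-comm a b)) (sym (lca-∷-≡ i b a)))
... | no i≢j   = trans (lca-∷-≢ a b i≢j) (sym (lca-∷-≢ b a (i≢j ∘ sym)))

lca-⪯ˡ : ∀ a b → a ⪯ lca a b
lca-⪯ˡ []      b       = ⪯-refl []
lca-⪯ˡ (i ∷ a) []      = ⪯-root (i ∷ a)
lca-⪯ˡ (i ∷ a) (j ∷ b) with i ≡ᵇ j
... | true  = ⪯-∷ (lca-⪯ˡ a b)
... | false = ⪯-root (i ∷ a)

lca-⪯ʳ : ∀ a b → b ⪯ lca a b
lca-⪯ʳ a b = subst (b ⪯_) (lca-comm b a) (lca-⪯ˡ b a)

module _ {V : Set} where

  LeafAt⇒∈leaves : ∀ {t : Tree V} {a x} → LeafAt t a x → x ∈ leaves t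
  LeafAt⇒∈leaves here                     = here refl
  LeafAt⇒∈leaves (there0 p)               = ∈-++⁺ˡ (LeafAt⇒∈leaves p)
  LeafAt⇒∈leaves (thereS {t = t} p)       = ∈-++⁺ʳ (leaves t) (LeafAt⇒∈leaves p)

  mutual
    ∈leaves⇒LeafAt : ∀ (t : Tree V) {x} → x ∈ leaves t → ∃[ a ] LeafAt t a x
    ∈leaves⇒LeafAt (leaf y)  (here refl) = [] , here
    ∈leaves⇒LeafAt (node ts) x∈          = ∈leavesL⇒LeafAt ts x∈

    ∈leavesL⇒LeafAt : ∀ (ts : List (Tree V)) {x} → x ∈ leavesL ts → ∃[ a ] LeafAt (node ts) a x
    ∈leavesL⇒LeafAt (t ∷ ts) x∈ with ∈-++⁻ (leaves t) x∈
    ... | inj₁ x∈t with ∈leaves⇒LeafAt t x∈t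
    ...   | a , p = 0 ∷ a , there0 p
    ∈leavesL⇒LeafAt (t ∷ ts) x∈ | inj₂ x∈ts with ∈leavesL⇒LeafAt ts x∈ts
    ...   | i ∷ a , p = suc i ∷ a , thereS p

  LeafAt-tabulate : ∀ {m} (f : Fin m → Tree V) j {a x} → LeafAt (f j) a x →
    LeafAt (node (tabulate f)) (toℕ j ∷ a) x
  LeafAt-tabulate f fzero    p = there0 p
  LeafAt-tabulate f (fsuc j) p = thereS (LeafAt-tabulate (f ∘ fsuc) j p)

  LeafAt-functional : ∀ {t : Tree V} {a x y} → LeafAt t a x → LeafAt t a y → x ≡ y
  LeafAt-functional here       here       = refl
  LeafAt-functional (there0 p) (there0 q) = LeafAt-functional p q
  LeafAt-functional (thereS p) (thereS q) = LeafAt-functional p q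

  LeafAt-injective : ∀ {t : Tree V} {a b x} → Unique (leaves t) → LeafAt t a x → LeafAt t b x → a ≡ b
  LeafAt-injective u here here = refl
  LeafAt-injective {node (t ∷ ts)} u p q with Unique-++⁻ (leaves t) u
  LeafAt-injective u (there0 p) (there0 q) | ut , _ , _ = cong (0 ∷_) (LeafAt-injective ut p q)
  LeafAt-injective u (there0 p) (thereS q) | _ , _ , disj = ⊥-elim (disj (LeafAt⇒∈leaves p , LeafAt⇒∈leaves q))
  LeafAt-injective u (thereS p) (there0 q) | _ , _ , disj = ⊥-elim (disj (LeafAt⇒∈leaves q , LeafAt⇒∈leaves p))
  LeafAt-injective u (thereS p) (thereS q) | _ , uts , _ with LeafAt-injective uts p q
  ... | refl = refl

  leaf-has-no-descendant : ∀ {t : Tree V} {a s x y} → LeafAt t a x → LeafAt t (a ++ s) y → s ≡ []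
  leaf-has-no-descendant {s = []}    here _ = refl
  leaf-has-no-descendant {s = _ ∷ _} here ()
  leaf-has-no-descendant (there0 p) (there0 q) = leaf-has-no-descendant p q
  leaf-has-no-descendant (thereS p) (thereS q) = leaf-has-no-descendant p q

  LeafAt-⪯⇒≡ : ∀ {t : Tree V} {ax ay x y} → LeafAt t ax x → LeafAt t ay y → ay ⪯ ax → x ≡ y
  LeafAt-⪯⇒≡ {ax = ax} px py (s , ax++s≡ay)
    with leaf-has-no-descendant px (subst (λ a → LeafAt _ a _) (sym ax++s≡ay) py)
  ... | refl = LeafAt-functional px (subst (λ a → LeafAt _ a _) (trans (sym ax++s≡ay) (++-identityʳ ax)) py)

module _ {N : ℕ} where
  private
    d : ℕ
    d = suc N

  toℕ-addMod : ∀ (i : Fin d) a → toℕ (addMod i a) ≡ (toℕ i + a) % d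
  toℕ-addMod i a = toℕ-fromℕ< _

  [m+n%d]%d≡[m+n]%d : ∀ m n → (m + n % d) % d ≡ (m + n) % d
  [m+n%d]%d≡[m+n]%d m n = begin
    (m + n % d) % d           ≡⟨ %-distribˡ-+ m (n % d) d ⟩
    (m % d + n % d % d) % d   ≡⟨ cong (λ z → (m % d + z) % d) (m%n%n≡m%n n d) ⟩
    (m % d + n % d) % d       ≡⟨ sym (%-distribˡ-+ m n d) ⟩
    (m + n) % d               ∎
    where open ≡-Reasoning

  addMod-+ : ∀ (i : Fin d) a b → addMod (addMod i a) b ≡ addMod i (a + b)
  addMod-+ i a b = toℕ-injective $ begin
    toℕ (addMod (addMod i a) b) ≡⟨ toℕ-addMod (addMod i a) b ⟩
    (toℕ (addMod i a) + b) % d  ≡⟨ cong (λ z → (z + b) % d) (toℕ-addMod i a) ⟩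
    ((toℕ i + a) % d + b) % d   ≡⟨ cong (_% d) (+-comm ((toℕ i + a) % d) b) ⟩
    (b + (toℕ i + a) % d) % d   ≡⟨ [m+n%d]%d≡[m+n]%d b (toℕ i + a) ⟩
    (b + (toℕ i + a)) % d       ≡⟨ cong (_% d) (trans (+-comm b _) (+-assoc (toℕ i) a b)) ⟩
    (toℕ i + (a + b)) % d       ≡⟨ sym (toℕ-addMod i (a + b)) ⟩
    toℕ (addMod i (a + b))      ∎
    where open ≡-Reasoning

  addMod-0 : ∀ (i : Fin d) → addMod i 0 ≡ i
  addMod-0 i = toℕ-injective $ begin
    toℕ (addMod i 0)  ≡⟨ toℕ-addMod i 0 ⟩
    (toℕ i + 0) % d   ≡⟨ cong (_% d) (+-identityʳ (toℕ i)) ⟩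
    toℕ i % d         ≡⟨ m<n⇒m%n≡m (toℕ<n i) ⟩
    toℕ i             ∎
    where open ≡-Reasoning

  addMod-period : ∀ (i : Fin d) a → addMod i (a + d) ≡ addMod i a
  addMod-period i a = toℕ-injective $ begin
    toℕ (addMod i (a + d)) ≡⟨ toℕ-addMod i (a + d) ⟩
    (toℕ i + (a + d)) % d  ≡⟨ cong (_% d) (sym (+-assoc (toℕ i) a d)) ⟩
    (toℕ i + a + d) % d    ≡⟨ [m+n]%n≡m%n (toℕ i + a) d ⟩
    (toℕ i + a) % d        ≡⟨ sym (toℕ-addMod i a) ⟩
    toℕ (addMod i a)       ∎
    where open ≡-Reasoning

  addMod-suc : ∀ (i : Fin d) a → addMod (addMod i a) 1 ≡ addMod i (suc a)
  addMod-suc i a = trans (addMod-+ i a 1) (cong (addMod i) (+-comm a 1))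

  addMod-comm : ∀ (i : Fin d) a b → addMod (addMod i a) b ≡ addMod (addMod i b) a
  addMod-comm i a b = trans (addMod-+ i a b) (trans (cong (addMod i) (+-comm a b)) (sym (addMod-+ i b a)))

  addMod-pred : ∀ (i : Fin d) a → addMod (addMod i N) (suc a) ≡ addMod i a
  addMod-pred i a = begin
    addMod (addMod i N) (suc a) ≡⟨ addMod-+ i N (suc a) ⟩
    addMod i (N + suc a)        ≡⟨ cong (addMod i) (trans (+-suc N a) (+-comm d a)) ⟩
    addMod i (a + d)            ≡⟨ addMod-period i a ⟩
    addMod i a                  ∎
    where open ≡-Reasoning

  offset : Fin d → Fin d → ℕ
  offset m j = toℕ (addMod j (d ∸ toℕ m))

  offset<d : ∀ m j → offset m j < d
  offset<d m j = toℕ<n _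

  private
    m+[x+[d∸m]]≡x+d : ∀ (m : Fin d) x → toℕ m + (x + (d ∸ toℕ m)) ≡ x + d
    m+[x+[d∸m]]≡x+d m x = begin
      toℕ m + (x + (d ∸ toℕ m)) ≡⟨ cong (toℕ m +_) (+-comm x (d ∸ toℕ m)) ⟩
      toℕ m + ((d ∸ toℕ m) + x) ≡⟨ sym (+-assoc (toℕ m) (d ∸ toℕ m) x) ⟩
      toℕ m + (d ∸ toℕ m) + x   ≡⟨ cong (_+ x) (m+[n∸m]≡n (<⇒≤ (toℕ<n m))) ⟩
      d + x                     ≡⟨ +-comm d x ⟩
      x + d                     ∎
      where open ≡-Reasoning

  offset-addMod : ∀ (m : Fin d) {r} → r < d → offset m (addMod m r) ≡ r
  offset-addMod m {r} r<d = begin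
    toℕ (addMod (addMod m r) (d ∸ toℕ m)) ≡⟨ cong toℕ (addMod-+ m r (d ∸ toℕ m)) ⟩
    toℕ (addMod m (r + (d ∸ toℕ m)))      ≡⟨ toℕ-addMod m _ ⟩
    (toℕ m + (r + (d ∸ toℕ m))) % d       ≡⟨ cong (_% d) (m+[x+[d∸m]]≡x+d m r) ⟩
    (r + d) % d                           ≡⟨ [m+n]%n≡m%n r d ⟩
    r % d                                 ≡⟨ m<n⇒m%n≡m r<d ⟩
    r                                     ∎
    where open ≡-Reasoning

  addMod-offset : ∀ (m j : Fin d) → addMod m (offset m j) ≡ j
  addMod-offset m j = toℕ-injective $ begin
    toℕ (addMod m (offset m j))                 ≡⟨ toℕ-addMod m _ ⟩
    (toℕ m + offset m j) % d                    ≡⟨ cong (λ z → (toℕ m + z) % d) (toℕ-addMod j _) ⟩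
    (toℕ m + (toℕ j + (d ∸ toℕ m)) % d) % d     ≡⟨ [m+n%d]%d≡[m+n]%d (toℕ m) _ ⟩
    (toℕ m + (toℕ j + (d ∸ toℕ m))) % d         ≡⟨ cong (_% d) (m+[x+[d∸m]]≡x+d m (toℕ j)) ⟩
    (toℕ j + d) % d                             ≡⟨ [m+n]%n≡m%n (toℕ j) d ⟩
    toℕ j % d                                   ≡⟨ m<n⇒m%n≡m (toℕ<n j) ⟩
    toℕ j                                       ∎
    where open ≡-Reasoning

  addMod-injective : ∀ (m : Fin d) {r s} → r < d → s < d → addMod m r ≡ addMod m s → r ≡ s
  addMod-injective m {r} {s} r<d s<d eq =
    trans (sym (offset-addMod m r<d)) (trans (cong (offset m) eq) (offset-addMod m s<d))

  addMod-surjective : ∀ (P : Fin d → Set) m → (∀ r → r < d → P (addMod m r)) → ∀ j → P j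
  addMod-surjective P m P+ j = subst P (addMod-offset m j) (P+ (offset m j) (offset<d m j))

  addMod≢ : ∀ (i : Fin d) {a} → 0 < a → a < d → addMod i a ≢ i
  addMod≢ i 0<a a<d eq = <⇒≢ 0<a (sym (addMod-injective i a<d (s≤s z≤n) (trans eq (sym (addMod-0 i)))))

  toℕ-addMod≢ : ∀ (i : Fin d) {a} → 0 < a → a < d → toℕ (addMod i a) ≢ toℕ i
  toℕ-addMod≢ i 0<a a<d = addMod≢ i 0<a a<d ∘ toℕ-injective

-- Binary trees and rooted triples

data BinTree (V : Set) : Set where
  tip  : V → BinTree V
  fork : BinTree V → BinTree V → BinTree V

module _ {V : Set} where

  toTree : BinTree V → Tree V
  toTree (tip v)    = leaf v
  toTree (fork l r) = node (toTree l ∷ toTree r ∷ [])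

  tips : BinTree V → List V
  tips (tip v)    = v ∷ []
  tips (fork l r) = tips l ++ tips r

  leaves-toTree : ∀ t → leaves (toTree t) ≡ tips t
  leaves-toTree (tip v)    = refl
  leaves-toTree (fork l r) rewrite ++-identityʳ (leaves (toTree r)) | leaves-toTree l | leaves-toTree r = refl

  toTree-phylo : ∀ t → Phylo (toTree t)
  toTree-phylo (tip v)    = leafP
  toTree-phylo (fork l r) = nodeP (s≤s (s≤s z≤n)) (toTree-phylo l ∷ toTree-phylo r ∷ [])

  toTree-binary : ∀ t → Binary (toTree t)
  toTree-binary (tip v)    = leafB
  toTree-binary (fork l r) = nodeB (toTree-binary l) (toTree-binary r)

  LeafAt⇒∈tips : ∀ {t a x} → LeafAt (toTree t) a x → x ∈ tips t
  LeafAt⇒∈tips {t} p = subst (_ ∈_) (leaves-toTree t) (LeafAt⇒∈leaves p)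

  data Displays : BinTree V → V → V → V → Set where
    rootˡ : ∀ {l r a b c} → a ∈ tips l → b ∈ tips l → c ∈ tips r → Displays (fork l r) a b c
    rootʳ : ∀ {l r a b c} → a ∈ tips r → b ∈ tips r → c ∈ tips l → Displays (fork l r) a b c
    inˡ   : ∀ {l r a b c} → Displays l a b c → Displays (fork l r) a b c
    inʳ   : ∀ {l r a b c} → Displays r a b c → Displays (fork l r) a b c

  Displays⇒∈tips : ∀ {t a b c} → Displays t a b c → a ∈ tips t × b ∈ tips t × c ∈ tips t
  Displays⇒∈tips (rootˡ {l} a∈ b∈ c∈) = ∈-++⁺ˡ a∈ , ∈-++⁺ˡ b∈ , ∈-++⁺ʳ (tips l) c∈
  Displays⇒∈tips (rootʳ {l} a∈ b∈ c∈) = ∈-++⁺ʳ (tips l) a∈ , ∈-++⁺ʳ (tips l) b∈ , ∈-++⁺ˡ c∈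
  Displays⇒∈tips (inˡ D) with Displays⇒∈tips D
  ... | a∈ , b∈ , c∈ = ∈-++⁺ˡ a∈ , ∈-++⁺ˡ b∈ , ∈-++⁺ˡ c∈
  Displays⇒∈tips (inʳ {l} D) with Displays⇒∈tips D
  ... | a∈ , b∈ , c∈ = ∈-++⁺ʳ (tips l) a∈ , ∈-++⁺ʳ (tips l) b∈ , ∈-++⁺ʳ (tips l) c∈

  LeafAt-forkˡ : ∀ {l r p x} → Disjoint (tips l) (tips r) → x ∈ tips l →
    LeafAt (toTree (fork l r)) p x → ∃[ q ] (p ≡ 0 ∷ q × LeafAt (toTree l) q x)
  LeafAt-forkˡ disj x∈l (there0 q)           = _ , refl , q
  LeafAt-forkˡ disj x∈l (thereS (there0 q))  = ⊥-elim (disj (x∈l , LeafAt⇒∈tips q))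

  LeafAt-forkʳ : ∀ {l r p x} → Disjoint (tips l) (tips r) → x ∈ tips r →
    LeafAt (toTree (fork l r)) p x → ∃[ q ] (p ≡ 1 ∷ q × LeafAt (toTree r) q x)
  LeafAt-forkʳ disj x∈r (there0 q)           = ⊥-elim (disj (LeafAt⇒∈tips q , x∈r))
  LeafAt-forkʳ disj x∈r (thereS (there0 q))  = _ , refl , q

  Displays⇒lca : ∀ {t a b c pa pb pc} → Unique (tips t) → Displays t a b c →
    LeafAt (toTree t) pa a → LeafAt (toTree t) pb b → LeafAt (toTree t) pc c →
    lca pa pb ≺ lca pa pc × lca pa pc ≡ lca pb pc
  Displays⇒lca {fork l r} u D la lb lc with Unique-++⁻ (tips l) u
  Displays⇒lca u (rootˡ a∈ b∈ c∈) la lb lc | _ , _ , disj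
    with LeafAt-forkˡ disj a∈ la | LeafAt-forkˡ disj b∈ lb | LeafAt-forkʳ disj c∈ lc
  ... | _ , refl , _ | _ , refl , _ | _ , refl , _ = (⪯-root _ , root⋠∷) , refl
  Displays⇒lca u (rootʳ a∈ b∈ c∈) la lb lc | _ , _ , disj
    with LeafAt-forkʳ disj a∈ la | LeafAt-forkʳ disj b∈ lb | LeafAt-forkˡ disj c∈ lc
  ... | _ , refl , _ | _ , refl , _ | _ , refl , _ = (⪯-root _ , root⋠∷) , refl
  Displays⇒lca u (inˡ D) la lb lc | ul , _ , disj with Displays⇒∈tips D
  ... | a∈ , b∈ , c∈ with LeafAt-forkˡ disj a∈ la | LeafAt-forkˡ disj b∈ lb | LeafAt-forkˡ disj c∈ lc
  ...   | _ , refl , qa | _ , refl , qb | _ , refl , qc with Displays⇒lca ul D qa qb qc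
  ...     | below , same = ≺-∷ below , cong (0 ∷_) same
  Displays⇒lca u (inʳ D) la lb lc | _ , ur , disj with Displays⇒∈tips D
  ... | a∈ , b∈ , c∈ with LeafAt-forkʳ disj a∈ la | LeafAt-forkʳ disj b∈ lb | LeafAt-forkʳ disj c∈ lc
  ...   | _ , refl , qa | _ , refl , qb | _ , refl , qc with Displays⇒lca ur D qa qb qc
  ...     | below , same = ≺-∷ below , cong (1 ∷_) same

side : Addr → Bool
side (0 ∷ _) = false
side _       = true

module _ {V : Set} {l r : Tree V} where

  lca≡[]⇔side≢ : ∀ {p q v w} → LeafAt (node (l ∷ r ∷ [])) p v → LeafAt (node (l ∷ r ∷ [])) q w →
    (lca p q ≡ []) ⇔ (side p ≢ side q)
  lca≡[]⇔side≢ (there0 _)          (there0 _)          = mk⇔ (λ ()) (λ s≢s → ⊥-elim (s≢s refl))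
  lca≡[]⇔side≢ (there0 _)          (thereS (there0 _)) = mk⇔ (λ _ ()) (λ _ → refl)
  lca≡[]⇔side≢ (thereS (there0 _)) (there0 _)          = mk⇔ (λ _ ()) (λ _ → refl)
  lca≡[]⇔side≢ (thereS (there0 _)) (thereS (there0 _)) = mk⇔ (λ ()) (λ s≢s → ⊥-elim (s≢s refl))

  same-side-of-ancestor : ∀ {pa pb pc a b c} → LeafAt (node (l ∷ r ∷ [])) pa a →
    LeafAt (node (l ∷ r ∷ [])) pb b → LeafAt (node (l ∷ r ∷ [])) pc c →
    lca pa pc ⪯ lca pa pb → side pa ≡ side pb → side pa ≡ side pc
  same-side-of-ancestor {pa} {pb} {pc} la lb lc ac⪯ab sa≡sb with side pa ≟ᵇ side pc
  ... | yes sa≡sc = sa≡sc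
  ... | no  sa≢sc = ⊥-elim (Equivalence.to (lca≡[]⇔side≢ la lb) lca-ab≡[] sa≡sb)
    where
      lca-ab≡[] : lca pa pb ≡ []
      lca-ab≡[] = []⪯⇒≡[] (subst (_⪯ lca pa pb) (Equivalence.from (lca≡[]⇔side≢ la lc) sa≢sc) ac⪯ab)

Binary⇒leaf : ∀ {V : Set} {t : Tree V} → Binary t → ∃[ a ] ∃[ x ] LeafAt t a x
Binary⇒leaf (leafB {x}) = [] , x , here
Binary⇒leaf (nodeB bl _) with Binary⇒leaf bl
... | a , x , p = 0 ∷ a , x , there0 p

module _ {V : Set} where

  tipsᴹ : Maybe (BinTree V) → List V
  tipsᴹ nothing  = []
  tipsᴹ (just t) = tips t

  Displaysᴹ : Maybe (BinTree V) → V → V → V → Set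
  Displaysᴹ nothing  a b c = ⊥
  Displaysᴹ (just t) a b c = Displays t a b c

  forkᴹ : Maybe (BinTree V) → Maybe (BinTree V) → Maybe (BinTree V)
  forkᴹ nothing  B        = B
  forkᴹ (just l) nothing  = just l
  forkᴹ (just l) (just r) = just (fork l r)

  tipsᴹ-forkᴹ : ∀ A B → tipsᴹ (forkᴹ A B) ≡ tipsᴹ A ++ tipsᴹ B
  tipsᴹ-forkᴹ nothing  B        = refl
  tipsᴹ-forkᴹ (just l) nothing  = sym (++-identityʳ (tips l))
  tipsᴹ-forkᴹ (just l) (just r) = refl

  ∈-forkᴹ⁻ : ∀ A B {v} → v ∈ tipsᴹ (forkᴹ A B) → v ∈ tipsᴹ A ⊎ v ∈ tipsᴹ B
  ∈-forkᴹ⁻ A B v∈ = ∈-++⁻ (tipsᴹ A) (subst (_ ∈_) (tipsᴹ-forkᴹ A B) v∈)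

  ∈-forkᴹ⁺ˡ : ∀ A B {v} → v ∈ tipsᴹ A → v ∈ tipsᴹ (forkᴹ A B)
  ∈-forkᴹ⁺ˡ A B v∈ = subst (_ ∈_) (sym (tipsᴹ-forkᴹ A B)) (∈-++⁺ˡ v∈)

  ∈-forkᴹ⁺ʳ : ∀ A B {v} → v ∈ tipsᴹ B → v ∈ tipsᴹ (forkᴹ A B)
  ∈-forkᴹ⁺ʳ A B v∈ = subst (_ ∈_) (sym (tipsᴹ-forkᴹ A B)) (∈-++⁺ʳ (tipsᴹ A) v∈)

  Unique-forkᴹ : ∀ A B → Unique (tipsᴹ A) → Unique (tipsᴹ B) → Disjoint (tipsᴹ A) (tipsᴹ B) →
    Unique (tipsᴹ (forkᴹ A B))
  Unique-forkᴹ A B uA uB disj = subst Unique (sym (tipsᴹ-forkᴹ A B)) (++⁺ uA uB disj)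

  rootˡᴹ : ∀ A B {a b c} → a ∈ tipsᴹ A → b ∈ tipsᴹ A → c ∈ tipsᴹ B → Displaysᴹ (forkᴹ A B) a b c
  rootˡᴹ (just l) (just r) = rootˡ

  rootʳᴹ : ∀ A B {a b c} → a ∈ tipsᴹ B → b ∈ tipsᴹ B → c ∈ tipsᴹ A → Displaysᴹ (forkᴹ A B) a b c
  rootʳᴹ (just l) (just r) = rootʳ

  inˡᴹ : ∀ A B {a b c} → Displaysᴹ A a b c → Displaysᴹ (forkᴹ A B) a b c
  inˡᴹ (just l) nothing  D = D
  inˡᴹ (just l) (just r) D = inˡ D

  inʳᴹ : ∀ A B {a b c} → Displaysᴹ B a b c → Displaysᴹ (forkᴹ A B) a b c
  inʳᴹ nothing  (just r) D = D
  inʳᴹ (just l) (just r) D = inʳ D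

-- Caterpillars

module Caterpillar {V : Set} {P : V → Set} (P? : Decidable P) where

  tipᴹ : V → Maybe (BinTree V)
  tipᴹ v with P? v
  ... | yes _ = just (tip v)
  ... | no _  = nothing

  ∈-tipᴹ⁺ : ∀ {v} → P v → v ∈ tipsᴹ (tipᴹ v)
  ∈-tipᴹ⁺ {v} pv with P? v
  ... | yes _  = here refl
  ... | no ¬pv = ⊥-elim (¬pv pv)

  ∈-tipᴹ⁻ : ∀ {v w} → w ∈ tipsᴹ (tipᴹ v) → w ≡ v × P v
  ∈-tipᴹ⁻ {v} w∈ with P? v
  ∈-tipᴹ⁻ (here refl) | yes pv = refl , pv

  Unique-tipᴹ : ∀ v → Unique (tipsᴹ (tipᴹ v))
  Unique-tipᴹ v with P? v
  ... | yes _ = [] ∷ []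
  ... | no _  = []

  caterpillar : Maybe (BinTree V) → (ℕ → V) → ℕ → Maybe (BinTree V)
  caterpillar base f zero    = base
  caterpillar base f (suc i) = forkᴹ (tipᴹ (f i)) (caterpillar base f i)

  module _ (base : Maybe (BinTree V)) (f : ℕ → V) where

    ∈-caterpillar⁻ : ∀ n {v} → v ∈ tipsᴹ (caterpillar base f n) →
      v ∈ tipsᴹ base ⊎ (P v × ∃[ j ] (j < n × v ≡ f j))
    ∈-caterpillar⁻ zero    v∈ = inj₁ v∈
    ∈-caterpillar⁻ (suc n) v∈ with ∈-forkᴹ⁻ (tipᴹ (f n)) (caterpillar base f n) v∈
    ... | inj₁ v∈tip with ∈-tipᴹ⁻ v∈tip
    ...   | refl , pv = inj₂ (pv , n , ≤-refl , refl)
    ∈-caterpillar⁻ (suc n) v∈ | inj₂ v∈rest with ∈-caterpillar⁻ n v∈rest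
    ...   | inj₁ v∈base = inj₁ v∈base
    ...   | inj₂ (pv , j , j<n , v≡fj) = inj₂ (pv , j , m≤n⇒m≤1+n j<n , v≡fj)

    ∈-caterpillar⁺ : ∀ {n j} → j < n → P (f j) → f j ∈ tipsᴹ (caterpillar base f n)
    ∈-caterpillar⁺ {suc n} j<1+n pfj with m≤n⇒m<n∨m≡n (≤-pred j<1+n)
    ... | inj₂ refl = ∈-forkᴹ⁺ˡ (tipᴹ (f n)) (caterpillar base f n) (∈-tipᴹ⁺ pfj)
    ... | inj₁ j<n  = ∈-forkᴹ⁺ʳ (tipᴹ (f n)) (caterpillar base f n) (∈-caterpillar⁺ j<n pfj)

    base⊆caterpillar : ∀ n {v} → v ∈ tipsᴹ base → v ∈ tipsᴹ (caterpillar base f n)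
    base⊆caterpillar zero    v∈ = v∈
    base⊆caterpillar (suc n) v∈ = ∈-forkᴹ⁺ʳ (tipᴹ (f n)) (caterpillar base f n) (base⊆caterpillar n v∈)

    Unique-caterpillar : ∀ n → Unique (tipsᴹ base) →
      (∀ {i j} → i < n → j < n → f i ≡ f j → i ≡ j) → (∀ {j} → j < n → f j ∉ tipsᴹ base) →
      Unique (tipsᴹ (caterpillar base f n))
    Unique-caterpillar zero    ubase _ _ = ubase
    Unique-caterpillar (suc n) ubase f-inj f∉base =
      Unique-forkᴹ (tipᴹ (f n)) (caterpillar base f n) (Unique-tipᴹ (f n))
        (Unique-caterpillar n ubase (λ i<n j<n → f-inj (m<n⇒m<1+n i<n) (m<n⇒m<1+n j<n)) (f∉base ∘ m<n⇒m<1+n))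
        disjoint
      where
        disjoint : Disjoint (tipsᴹ (tipᴹ (f n))) (tipsᴹ (caterpillar base f n))
        disjoint (v∈tip , v∈rest) with ∈-tipᴹ⁻ v∈tip | ∈-caterpillar⁻ n v∈rest
        ... | refl , _ | inj₁ v∈base           = f∉base ≤-refl v∈base
        ... | refl , _ | inj₂ (_ , j , j<n , fn≡fj) = <-irrefl (sym (f-inj ≤-refl (m<n⇒m<1+n j<n) fn≡fj)) j<n

    caterpillar-displays : ∀ {n i a b} → i < n → P (f i) →
      a ∈ tipsᴹ (caterpillar base f i) → b ∈ tipsᴹ (caterpillar base f i) →
      Displaysᴹ (caterpillar base f n) a b (f i)
    caterpillar-displays {suc n} i<1+n pfi a∈ b∈ with m≤n⇒m<n∨m≡n (≤-pred i<1+n)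
    ... | inj₂ refl = rootʳᴹ (tipᴹ (f n)) (caterpillar base f n) a∈ b∈ (∈-tipᴹ⁺ pfi)
    ... | inj₁ i<n  = inʳᴹ (tipᴹ (f n)) (caterpillar base f n) (caterpillar-displays i<n pfi a∈ b∈)

module Graph (k′ : ℕ) where

  k : ℕ
  k = 2 + k′

  n : ℕ
  n = 2 * k

  V : Set
  V = Vtx k

  _≟ᵛ_ : DecidableEquality V
  _≟ᵛ_ = ≡-dec _≟ᶠ_ _≟ᵇ_

  open import Data.List.Membership.DecPropositional _≟ᵛ_ using (_∈?_)

  k<n : k < n
  k<n = m<m+n k {k + 0} (s≤s z≤n)

  1+k<n : suc k < n
  1+k<n = subst (_< n) (+-comm k 1) (+-monoʳ-< k {1} {k + 0} (s≤s (s≤s z≤n)))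

  arcColour : V → Fin n
  arcColour (i , false) = addMod i k
  arcColour (i , true)  = addMod i 1

  arcColour≢col : ∀ v → arcColour v ≢ col {k} v
  arcColour≢col (i , false) = addMod≢ i (s≤s z≤n) k<n
  arcColour≢col (i , true)  = addMod≢ i (s≤s z≤n) (≤-trans (s≤s (s≤s z≤n)) k<n)

  RootAllowed : List V → V → Set
  RootAllowed W (i , false) = ⊤
  RootAllowed W (i , true)  = (addMod i 1 , false) ∈ W

  rootAllowed? : ∀ W v → Dec (RootAllowed W v)
  rootAllowed? W (i , false) = yes tt
  rootAllowed? W (i , true)  = (addMod i 1 , false) ∈? W

  address : Tree V → V → Addr
  address T v with v ∈? leaves T
  ... | yes v∈ = proj₁ (∈leaves⇒LeafAt T v∈)
  ... | no _   = []

  LeafAt-address : ∀ {T a v} → LeafAt T a v → LeafAt T (address T v) v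
  LeafAt-address {T} {v = v} p with v ∈? leaves T
  ... | yes v∈ = proj₂ (∈leaves⇒LeafAt T v∈)
  ... | no v∉  = ⊥-elim (v∉ (LeafAt⇒∈leaves p))

  -- Truncating at the root turns every best match of colour c into a quasi-best match; for z_i this is
  -- wrong once x_{i+1} ∉ W, as z_{i+1} then becomes a best match of z_i.
  truncation : Tree V → List V → V → Fin n → Addr
  truncation T W v c with c ≟ᶠ arcColour v | rootAllowed? W v
  ... | yes _ | yes _ = []
  ... | _     | _     = address T v

  truncation-cases : ∀ T W v c → truncation T W v c ≡ address T v ⊎ (c ≡ arcColour v × RootAllowed W v)
  truncation-cases T W v c with c ≟ᶠ arcColour v | rootAllowed? W v
  ... | yes c≡ | yes out = inj₂ (c≡ , out)
  ... | yes _  | no _    = inj₁ refl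
  ... | no _   | _       = inj₁ refl

  truncation-root : ∀ T W v → RootAllowed W v → truncation T W v (arcColour v) ≡ []
  truncation-root T W v out with arcColour v ≟ᶠ arcColour v | rootAllowed? W v
  ... | yes _  | yes _  = refl
  ... | yes _  | no ¬out = ⊥-elim (¬out out)
  ... | no c≢c | _      = ⊥-elim (c≢c refl)

  ZTriples : Tree V → Set
  ZTriples T = ∀ j {pa pb pc} → LeafAt T pa (j , true) → LeafAt T pb (addMod j 1 , false) →
    LeafAt T pc (addMod j 1 , true) → lca pa pb ≺ lca pa pc

  XTriples : Tree V → Set
  XTriples T = ∀ j {pa pb pc} → LeafAt T pa (j , false) → LeafAt T pb (addMod j k , false) →
    LeafAt T pc (addMod j k , true) → lca pa pb ≡ lca pa pc

  arc⇒arcColour : ∀ {v w} → Arc k v w → col {k} w ≡ arcColour v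
  arc⇒arcColour (xx i) = refl
  arc⇒arcColour (xz i) = refl
  arc⇒arcColour (zx i) = refl

  arc⇒rootAllowed : ∀ {W v w} → w ∈ W → Arc k v w → RootAllowed W v
  arc⇒rootAllowed w∈ (xx i) = tt
  arc⇒rootAllowed w∈ (xz i) = tt
  arc⇒rootAllowed w∈ (zx i) = w∈

  module _ (T : Tree V) (W : List V) (uW : Unique W) (T↭W : leaves T ↭ W)
           (zTriples : ZTriples T) (xTriples : XTriples T) where

    private
      u : V → Fin n → Addr
      u = truncation T W

      uT : Unique (leaves T)
      uT = Unique-resp-↭ (↭-sym T↭W) uW

      address-correct : ∀ {a v} → LeafAt T a v → address T v ≡ a
      address-correct p = LeafAt-injective uT (LeafAt-address p) p

    truncation-valid : Truncation (col {k}) T u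
    truncation-valid x ax px = below , at-colour
      where
        below : ∀ c → ax ⪯ u x c
        below c with truncation-cases T W x c
        ... | inj₁ eq = ⪯-reflexive (sym (trans eq (address-correct px)))
        ... | inj₂ (c≡ , out) = subst (ax ⪯_) (sym (trans (cong (u x) c≡) (truncation-root T W x out))) (⪯-root ax)
        at-colour : u x (col {k} x) ≡ ax
        at-colour with truncation-cases T W x (col {k} x)
        ... | inj₁ eq = trans eq (address-correct px)
        ... | inj₂ (c≡ , _) = ⊥-elim (arcColour≢col x (sym c≡))

    arc⇒bestMatch : ∀ {x ax y ay} → LeafAt T ax x → LeafAt T ay y → Arc k x y →
      ∀ y′ ay′ → LeafAt T ay′ y′ → col {k} y′ ≡ col {k} y → lca ax ay ⪯ lca ax ay′
    arc⇒bestMatch px py (xx i) (_ , false) _ py′ refl rewrite LeafAt-injective uT py′ py = ⪯-refl _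
    arc⇒bestMatch px py (xx i) (_ , true)  _ py′ refl = ⪯-reflexive (xTriples i px py py′)
    arc⇒bestMatch px py (xz i) (_ , true)  _ py′ refl rewrite LeafAt-injective uT py′ py = ⪯-refl _
    arc⇒bestMatch px py (xz i) (_ , false) _ py′ refl = ⪯-reflexive (sym (xTriples i px py′ py))
    arc⇒bestMatch px py (zx i) (_ , false) _ py′ refl rewrite LeafAt-injective uT py′ py = ⪯-refl _
    arc⇒bestMatch px py (zx i) (_ , true)  _ py′ refl = proj₁ (zTriples i px py py′)

    arc⇒quasiBestMatch : ∀ {x ax y ay} → LeafAt T ax x → LeafAt T ay y → Arc k x y →
      QuasiBestMatch (col {k}) T u x ax y ay
    arc⇒quasiBestMatch {x} {ax} {y} {ay} px py arc =
      (colours-differ , arc⇒bestMatch px py arc) , subst (lca ax ay ⪯_) (sym u-root) (⪯-root _)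
      where
        colours-differ : col {k} x ≢ col {k} y
        colours-differ eq = arcColour≢col x (trans (sym (arc⇒arcColour arc)) (sym eq))
        u-root : u x (col {k} y) ≡ []
        u-root rewrite arc⇒arcColour arc =
          truncation-root T W x (arc⇒rootAllowed (∈-resp-↭ T↭W (LeafAt⇒∈leaves py)) arc)

    quasiBestMatch⇒arc : ∀ {x ax y ay} → LeafAt T ax x → LeafAt T ay y →
      QuasiBestMatch (col {k}) T u x ax y ay → Arc k x y
    quasiBestMatch⇒arc {x} {ax} {y} {ay} px py ((colours-differ , bestMatch) , lca⪯u)
      with truncation-cases T W x (col {k} y)
    ... | inj₁ eq = ⊥-elim (colours-differ (cong (col {k}) (LeafAt-⪯⇒≡ px py (⪯-trans (lca-⪯ʳ ax ay) lca⪯ax))))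
      where
        lca⪯ax : lca ax ay ⪯ ax
        lca⪯ax = subst (lca ax ay ⪯_) (trans eq (address-correct px)) lca⪯u
    ... | inj₂ (c≡ , out) = by-colour x y c≡ out px py bestMatch
      where
        by-colour : ∀ x y {ax ay} → col {k} y ≡ arcColour x → RootAllowed W x → LeafAt T ax x → LeafAt T ay y →
          (∀ y′ ay′ → LeafAt T ay′ y′ → col {k} y′ ≡ col {k} y → lca ax ay ⪯ lca ax ay′) → Arc k x y
        by-colour (i , false) (_ , false) refl _ _ _ _ = xx i
        by-colour (i , false) (_ , true)  refl _ _ _ _ = xz i
        by-colour (i , true)  (_ , false) refl _ _ _ _ = zx i
        by-colour (i , true)  (_ , true)  refl out px py bestMatch
          with ∈leaves⇒LeafAt T (∈-resp-↭ (↭-sym T↭W) out)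
        ... | _ , pb = ⊥-elim (proj₂ (zTriples i px pb py) (bestMatch _ _ pb refl))

    truncation-explains : Explains (col {k}) T u (Arc k) W
    truncation-explains = T↭W , λ x ax y ay px py →
      mk⇔ (arc⇒quasiBestMatch px py) (quasiBestMatch⇒arc px py)

  ∈-allVtx : ∀ v → v ∈ allVtx k
  ∈-allVtx (i , true)  = ∈-cartesianProduct⁺ {xs = allFin n} {ys = true ∷ false ∷ []} (∈-allFin i) (here refl)
  ∈-allVtx (i , false) = ∈-cartesianProduct⁺ {xs = allFin n} {ys = true ∷ false ∷ []} (∈-allFin i) (there (here refl))

  Unique-allVtx : Unique (allVtx k)
  Unique-allVtx = cartesianProduct⁺ (allFin⁺ n) (((λ ()) ∷ []) ∷ [] ∷ [])

  -- The star of cherries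

  cherry : Fin n → Tree V
  cherry j = node (leaf (j , true) ∷ leaf (addMod j 1 , false) ∷ [])

  star : Tree V
  star = node (tabulate cherry)

  prev : Fin n → Fin n
  prev j = addMod j (pred n)

  LeafAt-star-z : ∀ j → LeafAt star (toℕ j ∷ 0 ∷ []) (j , true)
  LeafAt-star-z j = LeafAt-tabulate cherry j (there0 here)

  LeafAt-star-next-x : ∀ j → LeafAt star (toℕ j ∷ 1 ∷ []) (addMod j 1 , false)
  LeafAt-star-next-x j = LeafAt-tabulate cherry j (thereS (there0 here))

  LeafAt-star-x : ∀ j → LeafAt star (toℕ (prev j) ∷ 1 ∷ []) (j , false)
  LeafAt-star-x j = subst (λ i → LeafAt star (toℕ (prev j) ∷ 1 ∷ []) (i , false))
    (trans (addMod-pred j 0) (addMod-0 j)) (LeafAt-star-next-x (prev j))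

  unshift : V → V
  unshift (j , true)  = j , true
  unshift (j , false) = prev j , false

  unshift-leaves : ∀ js → map unshift (leavesL (map cherry js)) ≡ cartesianProduct js (true ∷ false ∷ [])
  unshift-leaves []       = refl
  unshift-leaves (j ∷ js) =
    cong₂ (λ i rest → (j , true) ∷ (i , false) ∷ rest)
      (trans (addMod-comm j 1 (pred n)) (trans (addMod-pred j 0) (addMod-0 j))) (unshift-leaves js)

  Unique-leaves-star : Unique (leaves star)
  Unique-leaves-star = map⁻ {f = unshift} $ subst (λ ts → Unique (map unshift (leavesL ts)))
    (map-tabulate id cherry) (subst Unique (sym (unshift-leaves (allFin n))) Unique-allVtx)

  leaves-star↭allVtx : leaves star ↭ allVtx k
  leaves-star↭allVtx = unique-same-elements⇒↭ Unique-leaves-star Unique-allVtx (λ {v} _ → ∈-allVtx v) ⊇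
    where
      ⊇ : ∀ {v} → v ∈ allVtx k → v ∈ leaves star
      ⊇ {j , true}  _ = LeafAt⇒∈leaves (LeafAt-star-z j)
      ⊇ {j , false} _ = LeafAt⇒∈leaves (LeafAt-star-x j)

  star-phylo : Phylo star
  star-phylo = nodeP (subst (2 ≤_) (sym (length-tabulate cherry)) (≤-trans (s≤s (s≤s z≤n)) (<⇒≤ k<n)))
    (tabulate⁺ {f = cherry} λ _ → nodeP (s≤s (s≤s z≤n)) (leafP ∷ leafP ∷ []))

  star-zTriples : ZTriples star
  star-zTriples j {pa} {pb} {pc} la lb lc
    rewrite LeafAt-injective Unique-leaves-star la (LeafAt-star-z j)
          | LeafAt-injective Unique-leaves-star lb (LeafAt-star-next-x j)
          | LeafAt-injective Unique-leaves-star lc (LeafAt-star-z (addMod j 1))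
          | lca-∷-≡ (toℕ j) (0 ∷ []) (1 ∷ [])
          | lca-∷-≢ (0 ∷ []) (0 ∷ []) (toℕ-addMod≢ j (s≤s z≤n) (≤-trans (s≤s (s≤s z≤n)) k<n) ∘ sym)
    = ⪯-root _ , root⋠∷

  star-xTriples : XTriples star
  star-xTriples j {pa} {pb} {pc} la lb lc
    rewrite LeafAt-injective Unique-leaves-star la (LeafAt-star-x j)
          | LeafAt-injective Unique-leaves-star lb (LeafAt-star-x (addMod j k))
          | LeafAt-injective Unique-leaves-star lc (LeafAt-star-z (addMod j k))
    = trans (lca-∷-≢ (1 ∷ []) (1 ∷ []) prev≢) (sym (lca-∷-≢ (1 ∷ []) (0 ∷ []) cherry≢))
    where
      prev≢ : toℕ (prev j) ≢ toℕ (prev (addMod j k))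
      prev≢ eq = toℕ-addMod≢ (prev j) (s≤s z≤n) k<n
        (sym (trans eq (cong toℕ (addMod-comm j k (pred n)))))
      cherry≢ : toℕ (prev j) ≢ toℕ (addMod j k)
      cherry≢ eq = toℕ-addMod≢ (prev j) (s≤s z≤n) 1+k<n
        (sym (trans eq (cong toℕ (sym (addMod-pred j k)))))

  star-isQBMG : IsQBMG (col {k}) (Arc k) (allVtx k)
  star-isQBMG = star , truncation star (allVtx k) , star-phylo ,
    truncation-valid star (allVtx k) Unique-allVtx leaves-star↭allVtx star-zTriples star-xTriples ,
    truncation-explains star (allVtx k) Unique-allVtx leaves-star↭allVtx star-zTriples star-xTriples

  -- The whole graph is not binary-explainable

  addMod-k-k : ∀ i → addMod (addMod i k) k ≡ i
  addMod-k-k i = trans (addMod-+ i k k)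
    (trans (cong (addMod i) (cong (k +_) (sym (+-identityʳ k)))) (trans (addMod-period i 0) (addMod-0 i)))

  module NotBinary {l r : Tree V} (u : V → Fin n → Addr)
    (explains : Explains (col {k}) (node (l ∷ r ∷ [])) u (Arc k) (allVtx k)) where

    private
      T : Tree V
      T = node (l ∷ r ∷ [])

      uT : Unique (leaves T)
      uT = Unique-resp-↭ (↭-sym (proj₁ explains)) Unique-allVtx

      located : ∀ v → ∃[ a ] LeafAt T a v
      located v = ∈leaves⇒LeafAt T (∈-resp-↭ (↭-sym (proj₁ explains)) (∈-allVtx v))

      addr : V → Addr
      addr v = proj₁ (located v)

      at : ∀ v → LeafAt T (addr v) v
      at v = proj₂ (located v)

      arc⇒qbm : ∀ {v w} → Arc k v w → QuasiBestMatch (col {k}) T u v (addr v) w (addr w)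
      arc⇒qbm = Equivalence.to (proj₂ explains _ _ _ _ (at _) (at _))

      qbm⇒arc : ∀ {v w} → QuasiBestMatch (col {k}) T u v (addr v) w (addr w) → Arc k v w
      qbm⇒arc = Equivalence.from (proj₂ explains _ _ _ _ (at _) (at _))

    sideOf : V → Bool
    sideOf v = side (addr v)

    -- otherwise u(z_j, c_{j+1}) is the root, which would make z_{j+1} a quasi-best match of z_j
    sideOf-z≡sideOf-x : ∀ j → sideOf (j , true) ≡ sideOf (addMod j 1 , false)
    sideOf-z≡sideOf-x j with sideOf (j , true) ≟ᵇ sideOf (addMod j 1 , false)
    ... | yes eq = eq
    ... | no  neq with arc⇒qbm (zx j)
    ...   | (col≢ , _) , lca⪯u with qbm⇒arc {w = (addMod j 1 , true)} ((col≢ , bestMatch) , lca⪯u′)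
      where
        lca-zx≡[] : lca (addr (j , true)) (addr (addMod j 1 , false)) ≡ []
        lca-zx≡[] = Equivalence.from (lca≡[]⇔side≢ (at _) (at _)) neq
        u-root : u (j , true) (addMod j 1) ≡ []
        u-root = []⪯⇒≡[] (subst (_⪯ u (j , true) (addMod j 1)) lca-zx≡[] lca⪯u)
        lca⪯u′ : lca (addr (j , true)) (addr (addMod j 1 , true)) ⪯ u (j , true) (addMod j 1)
        lca⪯u′ = subst (lca (addr (j , true)) (addr (addMod j 1 , true)) ⪯_) (sym u-root) (⪯-root _)
        bestMatch : ∀ y′ ay′ → LeafAt T ay′ y′ → col {k} y′ ≡ addMod j 1 →
          lca (addr (j , true)) (addr (addMod j 1 , true)) ⪯ lca (addr (j , true)) ay′
        bestMatch (_ , false) ay′ p refl rewrite LeafAt-injective uT p (at _) | lca-zx≡[] = ⪯-root _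
        bestMatch (_ , true)  ay′ p refl rewrite LeafAt-injective uT p (at _) = ⪯-refl _
    ... | ()

    -- x_j has both x_{j+k} and z_{j+k} as best matches, so they are on the same side
    sideOf-x≡sideOf-z : ∀ j → sideOf (j , false) ≡ sideOf (j , true)
    sideOf-x≡sideOf-z j = subst (λ i → sideOf (i , false) ≡ sideOf (i , true)) (addMod-k-k j) (same-side (addMod j k))
      where
        same-side : ∀ i → sideOf (addMod i k , false) ≡ sideOf (addMod i k , true)
        same-side i with sideOf (i , false) ≟ᵇ sideOf (addMod i k , false)
        ... | yes sa≡sb = trans (sym sa≡sb) (same-side-of-ancestor (at _) (at _) (at _) ac⪯ab sa≡sb)
          where ac⪯ab = proj₂ (proj₁ (arc⇒qbm (xz i))) _ _ (at _) refl
        ... | no sa≢sb = trans (¬-not (sa≢sb ∘ sym)) (sym (¬-not (sa≢sc ∘ sym)))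
          where
            ab⪯ac = proj₂ (proj₁ (arc⇒qbm (xx i))) _ _ (at _) refl
            sa≢sc = sa≢sb ∘ same-side-of-ancestor (at _) (at _) (at _) ab⪯ac

    sideOf-x-constant : ∀ r → sideOf (addMod fzero r , false) ≡ sideOf (fzero , false)
    sideOf-x-constant zero    = cong (λ i → sideOf (i , false)) (addMod-0 fzero)
    sideOf-x-constant (suc r) = begin
      sideOf (addMod fzero (suc r) , false)          ≡⟨ cong (λ i → sideOf (i , false)) (sym (addMod-suc fzero r)) ⟩
      sideOf (addMod (addMod fzero r) 1 , false)     ≡⟨ sym (sideOf-z≡sideOf-x (addMod fzero r)) ⟩
      sideOf (addMod fzero r , true)                 ≡⟨ sym (sideOf-x≡sideOf-z (addMod fzero r)) ⟩
      sideOf (addMod fzero r , false)                ≡⟨ sideOf-x-constant r ⟩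
      sideOf (fzero , false)                         ∎
      where open ≡-Reasoning

    sideOf-constant : ∀ v → sideOf v ≡ sideOf (fzero , false)
    sideOf-constant (j , b) = addMod-surjective (λ j → sideOf (j , b) ≡ sideOf (fzero , false)) fzero (by-bool b) j
      where
        by-bool : ∀ b r → r < n → sideOf (addMod fzero r , b) ≡ sideOf (fzero , false)
        by-bool false r _ = sideOf-x-constant r
        by-bool true  r _ = trans (sym (sideOf-x≡sideOf-z _)) (sideOf-x-constant r)

    one-sided : Binary l → Binary r → ⊥
    one-sided bl br with Binary⇒leaf bl | Binary⇒leaf br
    ... | _ , x , pl | _ , y , pr = false≢true $ begin
      false                  ≡⟨ cong side (sym (LeafAt-injective uT (at x) (there0 pl))) ⟩
      sideOf x               ≡⟨ sideOf-constant x ⟩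
      sideOf (fzero , false) ≡⟨ sym (sideOf-constant y) ⟩
      sideOf y               ≡⟨ cong side (LeafAt-injective uT (at y) (thereS (there0 pr))) ⟩
      true                   ∎
      where
        open ≡-Reasoning
        false≢true : false ≢ true
        false≢true ()

  full-not-binary : ¬ BinaryExplainable (col {k}) (Arc k) (allVtx k)
  full-not-binary (leaf v , _ , _ , leafB , _ , T↭ , _)
    with ∈-resp-↭ (↭-sym T↭) (∈-allVtx (fzero , true)) | ∈-resp-↭ (↭-sym T↭) (∈-allVtx (fzero , false))
  ... | here z≡v | here x≡v with trans z≡v (sym x≡v)
  ...   | ()
  full-not-binary (node (l ∷ r ∷ []) , u , _ , nodeB bl br , _ , explains) = NotBinary.one-sided u explains bl br

  ZDisplayed : List V → Maybe (BinTree V) → Set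
  ZDisplayed W A = ∀ j → (j , true) ∈ W → (addMod j 1 , false) ∈ W → (addMod j 1 , true) ∈ W →
    Displaysᴹ A (j , true) (addMod j 1 , false) (addMod j 1 , true)

  XDisplayed : List V → Maybe (BinTree V) → Set
  XDisplayed W A = ∀ j → (j , false) ∈ W → (addMod j k , false) ∈ W → (addMod j k , true) ∈ W →
    Displaysᴹ A (addMod j k , false) (addMod j k , true) (j , false)

  displaying-tree-explains : ∀ W (A : Maybe (BinTree V)) → Unique W → W ≢ [] → Unique (tipsᴹ A) →
    (∀ {v} → v ∈ tipsᴹ A → v ∈ W) → (∀ {v} → v ∈ W → v ∈ tipsᴹ A) →
    ZDisplayed W A → XDisplayed W A → BinaryExplainable (col {k}) (Arc k) W
  displaying-tree-explains []      _        _  W≢[] _ _ _ _ _ = ⊥-elim (W≢[] refl)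
  displaying-tree-explains (v ∷ W) nothing  _  _    _ _ ⊇ _ _ with ⊇ (here refl)
  ... | ()
  displaying-tree-explains W       (just t) uW _    ut ⊆ ⊇ zD xD =
    toTree t , truncation T W , toTree-phylo t , toTree-binary t ,
    truncation-valid T W uW T↭W zTriples xTriples , truncation-explains T W uW T↭W zTriples xTriples
    where
      T : Tree V
      T = toTree t
      T↭W : leaves T ↭ W
      T↭W = subst (_↭ W) (sym (leaves-toTree t)) (unique-same-elements⇒↭ ut uW ⊆ ⊇)
      inW : ∀ {a v} → LeafAt T a v → v ∈ W
      inW p = ⊆ (LeafAt⇒∈tips p)
      zTriples : ZTriples T
      zTriples j la lb lc = proj₁ (Displays⇒lca ut (zD j (inW la) (inW lb) (inW lc)) la lb lc)
      xTriples : XTriples T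
      xTriples j {pa} {pb} {pc} la lb lc =
        trans (lca-comm pa pb)
          (trans (proj₂ (Displays⇒lca ut (xD j (inW la) (inW lb) (inW lc)) lb lc la)) (lca-comm pc pa))

  -- Subgraphs missing a vertex

  n≡k+k : n ≡ k + k
  n≡k+k = cong (k +_) (+-identityʳ k)

  k+<n : ∀ {i} → i < k → k + i < n
  k+<n {i} i<k = subst (k + i <_) (sym n≡k+k) (+-monoʳ-< k i<k)

  split-halves : ∀ {r} → r < n → r < k ⊎ ∃[ i ] (r ≡ k + i × i < k)
  split-halves {r} r<n with r <? k
  ... | yes r<k = inj₁ r<k
  ... | no r≮k with m≤n⇒∃[o]m+o≡n (≮⇒≥ r≮k)
  ...   | i , k+i≡r = inj₂ (i , sym k+i≡r , +-cancelˡ-< k i k (subst₂ _<_ (sym k+i≡r) n≡k+k r<n))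

  module Deleted (m : Fin n) (W : List V) where
    open Caterpillar (_∈? W)

    X Z : ℕ → V
    X r = addMod m r , false
    Z r = addMod m r , true

    X-injective : ∀ {r s} → r < n → s < n → X r ≡ X s → r ≡ s
    X-injective r<n s<n = addMod-injective m r<n s<n ∘ cong proj₁

    Z-injective : ∀ {r s} → r < n → s < n → Z r ≡ Z s → r ≡ s
    Z-injective r<n s<n = addMod-injective m r<n s<n ∘ cong proj₁

    xPart : ℕ → ℕ → Maybe (BinTree V)
    xPart b c = caterpillar nothing (λ i → X (b + suc i)) c

    block : ℕ → ℕ → Maybe (BinTree V)
    block b c = caterpillar (xPart b c) (λ i → Z (b + i)) k

    ∈-block⁻ : ∀ b c {v} → v ∈ tipsᴹ (block b c) →
      v ∈ W × (∃[ i ] (i < k × v ≡ Z (b + i)) ⊎ ∃[ i ] (i < c × v ≡ X (b + suc i)))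
    ∈-block⁻ b c v∈ with ∈-caterpillar⁻ (xPart b c) (λ i → Z (b + i)) k v∈
    ... | inj₂ (v∈W , i , i<k , v≡) = v∈W , inj₁ (i , i<k , v≡)
    ... | inj₁ v∈X with ∈-caterpillar⁻ nothing (λ i → X (b + suc i)) c v∈X
    ...   | inj₂ (v∈W , i , i<c , v≡) = v∈W , inj₂ (i , i<c , v≡)

    ∈-blockᶻ : ∀ b c {i} → i < k → Z (b + i) ∈ W → Z (b + i) ∈ tipsᴹ (block b c)
    ∈-blockᶻ b c i<k z∈W = ∈-caterpillar⁺ (xPart b c) (λ i → Z (b + i)) i<k z∈W

    ∈-blockˣ : ∀ b c {i} → i < c → X (b + suc i) ∈ W → X (b + suc i) ∈ tipsᴹ (block b c)
    ∈-blockˣ b c i<c x∈W =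
      base⊆caterpillar (xPart b c) (λ i → Z (b + i)) k (∈-caterpillar⁺ nothing (λ i → X (b + suc i)) i<c x∈W)

    Unique-block : ∀ b c → b + c < n → b + k ≤ n → Unique (tipsᴹ (block b c))
    Unique-block b c b+c<n b+k≤n =
      Unique-caterpillar (xPart b c) _ k
        (Unique-caterpillar nothing _ c []
          (λ i<c j<c → suc-injective ∘ +-cancelˡ-≡ b _ _ ∘ X-injective (x<n i<c) (x<n j<c)) (λ _ ()))
        (λ i<k j<k → +-cancelˡ-≡ b _ _ ∘ Z-injective (z<n i<k) (z<n j<k))
        (λ _ z∈X → z∉X z∈X)
      where
        x<n : ∀ {i} → i < c → b + suc i < n
        x<n i<c = ≤-<-trans (+-monoʳ-≤ b i<c) b+c<n
        z<n : ∀ {i} → i < k → b + i < n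
        z<n i<k = <-≤-trans (+-monoʳ-< b i<k) b+k≤n
        z∉X : ∀ {i} → Z (b + i) ∉ tipsᴹ (xPart b c)
        z∉X z∈ with ∈-caterpillar⁻ nothing (λ i → X (b + suc i)) c z∈
        ... | inj₂ (_ , _ , _ , ())

    S₁ S₂ tree : Maybe (BinTree V)
    S₁   = block 0 k
    S₂   = block k (suc k′)
    tree = forkᴹ (tipᴹ (X 0)) (forkᴹ S₁ S₂)

    ∈-tree⁺ˡ : ∀ {v} → v ∈ tipsᴹ S₁ → v ∈ tipsᴹ tree
    ∈-tree⁺ˡ = ∈-forkᴹ⁺ʳ (tipᴹ (X 0)) (forkᴹ S₁ S₂) ∘ ∈-forkᴹ⁺ˡ S₁ S₂

    ∈-tree⁺ʳ : ∀ {v} → v ∈ tipsᴹ S₂ → v ∈ tipsᴹ tree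
    ∈-tree⁺ʳ = ∈-forkᴹ⁺ʳ (tipᴹ (X 0)) (forkᴹ S₁ S₂) ∘ ∈-forkᴹ⁺ʳ S₁ S₂

    k+k′<n : k + suc k′ < n
    k+k′<n = k+<n ≤-refl

    S₁#S₂ : Disjoint (tipsᴹ S₁) (tipsᴹ S₂)
    S₁#S₂ (v∈S₁ , v∈S₂) with proj₂ (∈-block⁻ 0 k v∈S₁) | proj₂ (∈-block⁻ k (suc k′) v∈S₂)
    ... | inj₁ (i , i<k , refl) | inj₁ (i′ , i′<k , eq) =
      m+n≮m k i′ (subst (_< k) (Z-injective (<-trans i<k k<n) (k+<n i′<k) eq) i<k)
    ... | inj₂ (i , i<k , refl) | inj₂ (i′ , i′<k′ , eq) =
      m+1+n≰m k (subst (_≤ k) (X-injective (≤-<-trans i<k k<n) (k+<n (s≤s i′<k′)) eq) i<k)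
    ... | inj₁ (_ , _ , refl) | inj₂ (_ , _ , ())
    ... | inj₂ (_ , _ , refl) | inj₁ (_ , _ , ())

    X₀∉block : ∀ b c → b + c < n → X 0 ∉ tipsᴹ (block b c)
    X₀∉block b c b+c<n x∈ with proj₂ (∈-block⁻ b c x∈)
    ... | inj₁ (_ , _ , ())
    ... | inj₂ (i , i<c , eq) = m+1+n≢0 b (sym (X-injective (s≤s z≤n) (≤-<-trans (+-monoʳ-≤ b i<c) b+c<n) eq))

    X₀#S : Disjoint (tipsᴹ (tipᴹ (X 0))) (tipsᴹ (forkᴹ S₁ S₂))
    X₀#S (v∈X₀ , v∈S) with ∈-tipᴹ⁻ v∈X₀ | ∈-forkᴹ⁻ S₁ S₂ v∈S
    ... | refl , _ | inj₁ v∈S₁ = X₀∉block 0 k k<n v∈S₁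
    ... | refl , _ | inj₂ v∈S₂ = X₀∉block k (suc k′) k+k′<n v∈S₂

    Unique-tree : Unique (tipsᴹ tree)
    Unique-tree = Unique-forkᴹ (tipᴹ (X 0)) (forkᴹ S₁ S₂) (Unique-tipᴹ (X 0))
      (Unique-forkᴹ S₁ S₂ (Unique-block 0 k k<n (<⇒≤ k<n))
        (Unique-block k (suc k′) k+k′<n (≤-reflexive (sym n≡k+k))) S₁#S₂)
      X₀#S

    tree⊆W : ∀ {v} → v ∈ tipsᴹ tree → v ∈ W
    tree⊆W v∈ with ∈-forkᴹ⁻ (tipᴹ (X 0)) (forkᴹ S₁ S₂) v∈
    ... | inj₁ v∈X₀ with ∈-tipᴹ⁻ v∈X₀
    ...   | refl , x∈W = x∈W
    tree⊆W v∈ | inj₂ v∈S with ∈-forkᴹ⁻ S₁ S₂ v∈S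
    ...   | inj₁ v∈S₁ = proj₁ (∈-block⁻ 0 k v∈S₁)
    ...   | inj₂ v∈S₂ = proj₁ (∈-block⁻ k (suc k′) v∈S₂)

    upper-half : ∀ {i} → suc (k + i) < n → i < suc k′
    upper-half {i} lt = ≤-pred (+-cancelˡ-< k (suc i) k (subst₂ _<_ (sym (+-suc k i)) n≡k+k lt))

    X-+-suc : ∀ a b → X (a + suc b) ≡ X (suc (a + b))
    X-+-suc a b = cong X (+-suc a b)

    W⊆tree : ∀ {v} → v ∈ W → v ∈ tipsᴹ tree
    W⊆tree {j , b} = addMod-surjective (λ j → (j , b) ∈ W → (j , b) ∈ tipsᴹ tree) m (by-offset b) j
      where
        by-offset : ∀ b r → r < n → (addMod m r , b) ∈ W → (addMod m r , b) ∈ tipsᴹ tree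
        by-offset true r r<n z∈W with split-halves r<n
        ... | inj₁ r<k              = ∈-tree⁺ˡ (∈-blockᶻ 0 k r<k z∈W)
        ... | inj₂ (i , refl , i<k) = ∈-tree⁺ʳ (∈-blockᶻ k (suc k′) i<k z∈W)
        by-offset false zero    _   x∈W = ∈-forkᴹ⁺ˡ (tipᴹ (X 0)) (forkᴹ S₁ S₂) (∈-tipᴹ⁺ x∈W)
        by-offset false (suc r) r<n x∈W with split-halves (<-trans (n<1+n r) r<n)
        ... | inj₁ r<k           = ∈-tree⁺ˡ (∈-blockˣ 0 k r<k x∈W)
        ... | inj₂ (i , refl , _) = ∈-tree⁺ʳ (subst (_∈ tipsᴹ S₂) (X-+-suc k i)
                (∈-blockˣ k (suc k′) (upper-half r<n) (subst (_∈ W) (sym (X-+-suc k i)) x∈W)))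

    Displaysᴹ-≡ : ∀ {A : Maybe (BinTree V)} {a a′ b b′ c c′} → a ≡ a′ → b ≡ b′ → c ≡ c′ →
      Displaysᴹ A a b c → Displaysᴹ A a′ b′ c′
    Displaysᴹ-≡ refl refl refl D = D

    block-displays : ∀ b c {i} → suc i < k → i < c → Z (b + i) ∈ W → X (b + suc i) ∈ W → Z (b + suc i) ∈ W →
      Displaysᴹ (block b c) (Z (b + i)) (X (b + suc i)) (Z (b + suc i))
    block-displays b c {i} 1+i<k i<c z∈W x′∈W z′∈W =
      caterpillar-displays (xPart b c) (λ i → Z (b + i)) 1+i<k z′∈W
        (∈-caterpillar⁺ (xPart b c) _ (n<1+n i) z∈W)
        (base⊆caterpillar (xPart b c) _ (suc i) (∈-caterpillar⁺ nothing _ i<c x′∈W))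

    module _ (incomplete : ¬ (X 0 ∈ W × Z 0 ∈ W)) where

      wraps-around : ∀ {a} → a ≡ n → X a ∈ W → Z a ∈ W → ⊥
      wraps-around refl x∈W z∈W = incomplete (subst (_∈ W) (cong (_, false) (addMod-period m 0)) x∈W ,
                                               subst (_∈ W) (cong (_, true) (addMod-period m 0)) z∈W)

      zDisplayed-at : ∀ r → r < n → Z r ∈ W → X (suc r) ∈ W → Z (suc r) ∈ W →
        Displaysᴹ tree (Z r) (X (suc r)) (Z (suc r))
      zDisplayed-at r r<n z∈W x′∈W z′∈W with split-halves r<n
      ... | inj₁ r<k with m≤n⇒m<n∨m≡n r<k
      ...   | inj₁ 1+r<k =
        inʳᴹ (tipᴹ (X 0)) (forkᴹ S₁ S₂) (inˡᴹ S₁ S₂ (block-displays 0 k 1+r<k r<k z∈W x′∈W z′∈W))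
      ...   | inj₂ 1+r≡k = inʳᴹ (tipᴹ (X 0)) (forkᴹ S₁ S₂) (rootˡᴹ S₁ S₂
                (∈-blockᶻ 0 k r<k z∈W) (∈-blockˣ 0 k r<k x′∈W)
                (subst (_∈ tipsᴹ S₂) (cong Z k+0≡1+r)
                  (∈-blockᶻ k (suc k′) (s≤s z≤n) (subst (_∈ W) (cong Z (sym k+0≡1+r)) z′∈W))))
        where
          k+0≡1+r : k + 0 ≡ suc r
          k+0≡1+r = trans (+-identityʳ k) (sym 1+r≡k)
      zDisplayed-at r r<n z∈W x′∈W z′∈W | inj₂ (i , refl , i<k) with m≤n⇒m<n∨m≡n i<k
      ...   | inj₁ 1+i<k = Displaysᴹ-≡ refl (X-+-suc k i) (cong Z (+-suc k i)) $
                inʳᴹ (tipᴹ (X 0)) (forkᴹ S₁ S₂) (inʳᴹ S₁ S₂ (block-displays k (suc k′) 1+i<k (≤-pred 1+i<k) z∈W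
                  (subst (_∈ W) (sym (X-+-suc k i)) x′∈W) (subst (_∈ W) (cong Z (sym (+-suc k i))) z′∈W)))
      ...   | inj₂ 1+i≡k =
        ⊥-elim (wraps-around (trans (sym (+-suc k i)) (trans (cong (k +_) 1+i≡k) (sym n≡k+k))) x′∈W z′∈W)

      xDisplayed-at : ∀ r → r < n → X r ∈ W → X (r + k) ∈ W → Z (r + k) ∈ W →
        Displaysᴹ tree (X (r + k)) (Z (r + k)) (X r)
      xDisplayed-at r r<n x∈W x′∈W z′∈W with split-halves r<n
      xDisplayed-at zero r<n x∈W x′∈W z′∈W | inj₁ _ =
        rootʳᴹ (tipᴹ (X 0)) (forkᴹ S₁ S₂) (∈-forkᴹ⁺ˡ S₁ S₂ (∈-blockˣ 0 k ≤-refl x′∈W))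
          (∈-forkᴹ⁺ʳ S₁ S₂ (subst (_∈ tipsᴹ S₂) (cong Z (+-identityʳ k))
            (∈-blockᶻ k (suc k′) (s≤s z≤n) (subst (_∈ W) (cong Z (sym (+-identityʳ k))) z′∈W))))
          (∈-tipᴹ⁺ x∈W)
      xDisplayed-at (suc r) r<n x∈W x′∈W z′∈W | inj₁ 1+r<k =
        Displaysᴹ-≡ (cong X (+-comm k (suc r))) (cong Z (+-comm k (suc r))) refl $
          inʳᴹ (tipᴹ (X 0)) (forkᴹ S₁ S₂) (rootʳᴹ S₁ S₂
            (∈-blockˣ k (suc k′) (≤-pred 1+r<k) (subst (_∈ W) (cong X (+-comm (suc r) k)) x′∈W))
            (∈-blockᶻ k (suc k′) 1+r<k (subst (_∈ W) (cong Z (+-comm (suc r) k)) z′∈W))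
            (∈-blockˣ 0 k (<-trans (n<1+n r) 1+r<k) x∈W))
      xDisplayed-at r r<n x∈W x′∈W z′∈W | inj₂ (zero , refl , _) =
        ⊥-elim (wraps-around (trans (cong (_+ k) (+-identityʳ k)) (sym n≡k+k)) x′∈W z′∈W)
      xDisplayed-at r r<n x∈W x′∈W z′∈W | inj₂ (suc i , refl , 1+i<k) =
        Displaysᴹ-≡ (sym (wrap false)) (sym (wrap true)) refl $
          inʳᴹ (tipᴹ (X 0)) (forkᴹ S₁ S₂) (rootˡᴹ S₁ S₂
            (∈-blockˣ 0 k (<-trans (n<1+n i) 1+i<k) (subst (_∈ W) (wrap false) x′∈W))
            (∈-blockᶻ 0 k 1+i<k (subst (_∈ W) (wrap true) z′∈W))
            (∈-blockˣ k (suc k′) (≤-pred 1+i<k) x∈W))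
        where
          wrap : ∀ b → (addMod m (k + suc i + k) , b) ≡ (addMod m (suc i) , b)
          wrap b = cong (_, b) (trans (cong (addMod m) k+a+k≡a+n) (addMod-period m (suc i)))
            where
              k+a+k≡a+n : k + suc i + k ≡ suc i + n
              k+a+k≡a+n =
                trans (cong (_+ k) (+-comm k (suc i))) (trans (+-assoc (suc i) k k) (cong (suc i +_) (sym n≡k+k)))

      deleted-binary : Unique W → W ≢ [] → BinaryExplainable (col {k}) (Arc k) W
      deleted-binary uW W≢[] =
        displaying-tree-explains W tree uW W≢[] Unique-tree tree⊆W W⊆tree zDisplayed xDisplayed
        where
          zDisplayed : ZDisplayed W tree
          zDisplayed = addMod-surjective
            (λ j → (j , true) ∈ W → (addMod j 1 , false) ∈ W → (addMod j 1 , true) ∈ W →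
                   Displaysᴹ tree (j , true) (addMod j 1 , false) (addMod j 1 , true)) m
            λ r r<n → subst (λ i → Z r ∈ W → (i , false) ∈ W → (i , true) ∈ W →
                                   Displaysᴹ tree (Z r) (i , false) (i , true))
                        (sym (addMod-suc m r)) (zDisplayed-at r r<n)
          xDisplayed : XDisplayed W tree
          xDisplayed = addMod-surjective
            (λ j → (j , false) ∈ W → (addMod j k , false) ∈ W → (addMod j k , true) ∈ W →
                   Displaysᴹ tree (addMod j k , false) (addMod j k , true) (j , false)) m
            λ r r<n → subst (λ i → X r ∈ W → (i , false) ∈ W → (i , true) ∈ W →
                                   Displaysᴹ tree (i , false) (i , true) (X r))
                        (sym (addMod-+ m r k)) (xDisplayed-at r r<n)

  length-allVtx : length (allVtx k) ≡ 4 * k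
  length-allVtx = begin
    length (allVtx k)                    ≡⟨ length-cartesianProduct (allFin n) (true ∷ false ∷ []) ⟩
    length (allFin n) * 2                ≡⟨ cong (_* 2) (length-tabulate {n = n} id) ⟩
    n * 2                                ≡⟨ *-comm n 2 ⟩
    2 * (2 * k)                          ≡⟨ sym (*-assoc 2 2 k) ⟩
    4 * k                                ∎
    where open ≡-Reasoning

  subgraph-binary : ∀ W → Unique W → W ≢ [] → length W + 2 ≤ 4 * k → BinaryExplainable (col {k}) (Arc k) W
  subgraph-binary W uW W≢[] short with ∃∉-shorter _≟ᵛ_ Unique-allVtx uW (λ {v} _ → ∈-allVtx v) shorter
    where
      shorter : length W < length (allVtx k)
      shorter = subst (length W <_) (sym length-allVtx) (<-≤-trans (m<m+n (length W) (s≤s z≤n)) short)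
  ... | (m , b) , v∉W = Deleted.deleted-binary m W (incomplete b v∉W) uW W≢[]
    where
      incomplete : ∀ {m} b → (m , b) ∉ W → ¬ (Deleted.X m W 0 ∈ W × Deleted.Z m W 0 ∈ W)
      incomplete {m} false v∉W (x∈W , _) = v∉W (subst (λ i → (i , false) ∈ W) (addMod-0 m) x∈W)
      incomplete {m} true  v∉W (_ , z∈W) = v∉W (subst (λ i → (i , true) ∈ W) (addMod-0 m) z∈W)

BinaryExplainable⇒IsQBMG : ∀ {V C : Set} {σ : V → C} {E W} → BinaryExplainable σ E W → IsQBMG σ E W
BinaryExplainable⇒IsQBMG (T , u , phylo , _ , valid , explains) = T , u , phylo , valid , explains

lemma10 : (k : ℕ) → 2 ≤ k →
    IsQBMG (col {k}) (Arc k) (allVtx k) ×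
    ¬ BinaryExplainable (col {k}) (Arc k) (allVtx k) ×
    ((W : List (Vtx k)) → Unique W → W ≢ [] → length W + 2 ≤ 4 * k →
       IsQBMG (col {k}) (Arc k) W × BinaryExplainable (col {k}) (Arc k) W)
lemma10 (suc (suc k′)) _ = star-isQBMG , full-not-binary , λ W uW W≢[] short →
  let binary = subgraph-binary W uW W≢[] short in BinaryExplainable⇒IsQBMG binary , binary
  where open Graph k′
lemma10 (suc zero) (s≤s ())
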